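{- Let $k$ be an odd integer and let $G$ be a $k$-edge-connected $k$-regular graph of order $n$. Then $\chi'(G)=k$ if and only if $\mathrm{rd}(G)=k$.
   Context: $\chi'(G)$ is the chromatic index (minimum number of colors in a proper edge-coloring). Given an edge-coloring (adjacent edges may share colors), a rainbow-cut is an edge-cut whose edges have pairwise distinct colors; $G$ is rainbow disconnected if every two distinct vertices $u,v$ lie in different components of $G-R$ for some rainbow-cut $R$. $\mathrm{rd}(G)$ is the minimum number of colors of an edge-coloring making $G$ rainbow disconnected. -}

module Defs where

open import Data.Nat using (ℕ; _<_; _%_)
open import Data.Fin using (Fin; _≟_)
open import Data.Bool using (Bool; true; false; _∧_; _∨_)
open import Data.List using (List; length; filterᵇ; map; allFin)
open import Data.Bool.ListAction using (any)
open import Data.List.Relation.Unary.All using (All)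
open import Data.List.Relation.Unary.AllPairs using (AllPairs)
open import Data.Product using (_×_; _,_; Σ; ∃)
open import Relation.Nullary using (¬_; ⌊_⌋)
open import Relation.Binary.PropositionalEquality using (_≡_; _≢_)

record Graph (n : ℕ) : Set where
  field
    adj    : Fin n → Fin n → Bool
    sym    : ∀ u v → adj u v ≡ adj v u
    irrefl : ∀ v → adj v v ≡ false
open Graph public

Edge : ℕ → Set
Edge n = Fin n × Fin n

IsEdge : ∀ {n} → Graph n → Edge n → Set
IsEdge G (u , v) = adj G u v ≡ true

degree : ∀ {n} → Graph n → Fin n → ℕ
degree {n} G v = length (filterᵇ (adj G v) (allFin n))

Regular : ∀ {n} → ℕ → Graph n → Set
Regular k G = ∀ v → degree G v ≡ k

sameEdge : ∀ {n} → Edge n → Edge n → Bool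
sameEdge (a , b) (c , d) = (⌊ a ≟ c ⌋ ∧ ⌊ b ≟ d ⌋) ∨ (⌊ a ≟ d ⌋ ∧ ⌊ b ≟ c ⌋)

inEdgeList : ∀ {n} → Edge n → List (Edge n) → Bool
inEdgeList e F = any (sameEdge e) F

-- v is reachable from u in the graph G − F (G with the edges listed in F deleted)
data Reach {n : ℕ} (G : Graph n) (F : List (Edge n)) : Fin n → Fin n → Set where
  here : ∀ {u} → Reach G F u u
  step : ∀ {u w v} → adj G u w ≡ true → inEdgeList (u , w) F ≡ false →
         Reach G F w v → Reach G F u v

EdgeConnected : ∀ {n} → ℕ → Graph n → Set
EdgeConnected {n} k G =
  (1 < n) × (∀ (F : List (Edge n)) → length F < k → ∀ u v → Reach G F u v)

-- edge-colourings with (at most) m colours: a colour for each pair,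
-- symmetric so that it is a function of the unordered edge
record EdgeColouring {n} (G : Graph n) (m : ℕ) : Set where
  field
    col    : Fin n → Fin n → Fin m
    colSym : ∀ u v → col u v ≡ col v u
open EdgeColouring public

Proper : ∀ {n m} {G : Graph n} → EdgeColouring G m → Set
Proper {G = G} c = ∀ u v w → v ≢ w → adj G u v ≡ true → adj G u w ≡ true →
  col c u v ≢ col c u w

-- a rainbow cut separating u and v: a list R of edges of G with pairwise
-- distinct colours such that u and v lie in different components of G − R
-- (in particular G − R is disconnected, so R is an edge-cut)
RainbowCutSeparating : ∀ {n m} {G : Graph n} → EdgeColouring G m →
  Fin n → Fin n → List (Edge n) → Set
RainbowCutSeparating {G = G} c u v R =
  All (IsEdge G) R ×
  AllPairs _≢_ (map (λ e → col c (Data.Product.proj₁ e) (Data.Product.proj₂ e)) R) ×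
  ¬ Reach G R u v

RainbowDisconnected : ∀ {n m} {G : Graph n} → EdgeColouring G m → Set
RainbowDisconnected {n} c = ∀ (u v : Fin n) → u ≢ v → ∃ λ R → RainbowCutSeparating c u v R

ProperColourable : ∀ {n} → Graph n → ℕ → Set
ProperColourable G m = Σ (EdgeColouring G m) Proper

RDColourable : ∀ {n} → Graph n → ℕ → Set
RDColourable G m = Σ (EdgeColouring G m) RainbowDisconnected

IsLeast : (ℕ → Set) → ℕ → Set
IsLeast P k = P k × (∀ m → m < k → ¬ P m)

ChromaticIndexIs : ∀ {n} → Graph n → ℕ → Set
ChromaticIndexIs G k = IsLeast (ProperColourable G) k

RDNumberIs : ∀ {n} → Graph n → ℕ → Set
RDNumberIs G k = IsLeast (RDColourable G) k

Odd : ℕ → Set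
Odd k = k % 2 ≡ 1

-- A proper k-colouring of a k-regular graph is rainbow disconnected: the star of u is a
-- rainbow cut isolating u. Fewer than k colours never suffice: a vertex has k incident edges,
-- and a rainbow cut has at most as many edges as colours while k-edge-connectivity needs k.
--
-- Conversely, fix a rainbow disconnected k-colouring, a vertex v and a colour j. For u ≠ v the
-- component X of u after deleting a rainbow cut separating u from v has a boundary of at most,
-- hence exactly, k edges, one of each colour. Counting degrees, k|X| ≡ |∂X| (mod 2), so for odd
-- k every set with |∂X| = k has odd size; by sub- and posimodularity of |∂| two such sets that
-- avoid v cannot cross. Hence the maximal ones partition V - v, and on each of them the sum of
-- deg_j + 1 is even, being ≡ |∂_j X| + |X| = 1 + 1. The same sum over V is even since n is even
-- (nk = 2|E|), so deg_j v + 1 is even: every colour appears an odd number of times, hence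
-- exactly once, at every vertex, i.e. the colouring is proper.

module Submission where

open import Data.Bool using (Bool; true; false; _∧_; _∨_; not; _xor_; T)
import Data.Bool.Properties as Bool
open import Data.Bool.ListAction using (any; or)
open import Data.Empty using (⊥; ⊥-elim)
open import Data.Fin using (Fin; zero; suc; _≟_)
import Data.Fin.Properties
open import Data.Fin.Properties using (all?; ¬∀⟶∃¬; injective⇒≤)
open import Data.List using (List; []; _∷_; length; map; lookup; filter; filterᵇ; allFin; tabulate; concatMap)
open import Data.List.Properties using (length-++; length-map; map-cong; filter-accept; filter-reject)
open import Data.List.Membership.Propositional using (_∈_; lose)
open import Data.List.Membership.Propositional.Properties using (∈-allFin; ∈-lookup; ∈-map⁺; ∈-filter⁺; ∈-concatMap⁺)
open import Data.List.Relation.Unary.All as All using (All; []; _∷_)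
import Data.List.Relation.Unary.All.Properties as All
open import Data.List.Relation.Unary.AllPairs using (AllPairs; []; _∷_)
import Data.List.Relation.Unary.AllPairs.Properties as AllPairs
open import Data.List.Relation.Unary.Any as Any using (Any; here; there; any?; satisfied)
open import Data.List.Relation.Unary.Any.Properties using (any⁺; any⁻)
import Data.List.Relation.Unary.Unique.Propositional.Properties as Unique
open import Data.Nat as ℕ using (ℕ; zero; suc; _+_; _*_; _≤_; _<_; z≤n; s≤s)
open import Data.Nat.Properties hiding (_≟_)
open import Algebra.Properties.Semiring.Sum +-*-semiring
  using (sum; sum-syntax; sum-cong-≗; sum-replicate-zero; ∑-distrib-+; ∑-comm; *-distribˡ-sum; *-distribʳ-sum)
open import Data.Product using (_×_; _,_; proj₁; proj₂; ∃)
open import Data.Sum using (_⊎_; inj₁; inj₂; [_,_]′)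
open import Function using (_∘_; id; Equivalence)
open import Function.Bundles using (_⇔_; mk⇔)
open import Relation.Nullary using (¬_; Dec; yes; no; contradiction; ⌊_⌋)
open import Relation.Nullary.Decidable using (dec-true; isYes≗does; _→-dec_)
open import Relation.Binary.PropositionalEquality hiding ([_])

open import Defs hiding (sym)

-- Finite sums and parity

[_] : Bool → ℕ
[ true ]  = 1
[ false ] = 0

[b]≤1 : ∀ b → [ b ] ≤ 1
[b]≤1 true  = s≤s z≤n
[b]≤1 false = z≤n

[∧]≡* : ∀ x y → [ x ∧ y ] ≡ [ y ] * [ x ]
[∧]≡* true  true  = refl
[∧]≡* true  false = refl
[∧]≡* false true  = refl
[∧]≡* false false = refl

sum-ones : ∀ n → ∑[ i < n ] 1 ≡ n
sum-ones zero    = refl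
sum-ones (suc n) = cong suc (sum-ones n)

sum-const : ∀ n c → ∑[ i < n ] c ≡ n * c
sum-const zero    c = refl
sum-const (suc n) c = cong (c +_) (sum-const n c)

sum-mono-≤ : ∀ {n} {f g : Fin n → ℕ} → (∀ i → f i ≤ g i) → sum f ≤ sum g
sum-mono-≤ {zero}  f≤g = z≤n
sum-mono-≤ {suc n} f≤g = +-mono-≤ (f≤g zero) (sum-mono-≤ (f≤g ∘ suc))

sum-mono-< : ∀ {n} {f g : Fin n → ℕ} → (∀ i → f i ≤ g i) → ∀ j → f j < g j → sum f < sum g
sum-mono-< {suc n} f≤g zero    fj<gj = +-mono-<-≤ fj<gj (sum-mono-≤ (f≤g ∘ suc))
sum-mono-< {suc n} f≤g (suc j) fj<gj = +-mono-≤-< (f≤g zero) (sum-mono-< (f≤g ∘ suc) j fj<gj)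

term≤sum : ∀ {n} (f : Fin n → ℕ) i → f i ≤ sum f
term≤sum f zero    = m≤m+n (f zero) _
term≤sum f (suc i) = ≤-trans (term≤sum (f ∘ suc) i) (m≤n+m _ (f zero))

two-terms≤sum : ∀ {n} (f : Fin n → ℕ) {i j} → i ≢ j → f i + f j ≤ sum f
two-terms≤sum f {zero}  {zero}  i≢j = contradiction refl i≢j
two-terms≤sum f {zero}  {suc j} i≢j = +-monoʳ-≤ (f zero) (term≤sum (f ∘ suc) j)
two-terms≤sum f {suc i} {zero}  i≢j =
  subst (_≤ sum f) (+-comm (f zero) (f (suc i))) (+-monoʳ-≤ (f zero) (term≤sum (f ∘ suc) i))
two-terms≤sum f {suc i} {suc j} i≢j = ≤-trans (two-terms≤sum (f ∘ suc) (i≢j ∘ cong suc)) (m≤n+m _ (f zero))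

sum-zero : ∀ {n} {f : Fin n → ℕ} → (∀ i → f i ≡ 0) → sum f ≡ 0
sum-zero {n} f≡0 = trans (sum-cong-≗ f≡0) (sum-replicate-zero n)

sum-positive : ∀ {n} (f : Fin n → ℕ) → 0 < sum f → ∃ λ i → 0 < f i
sum-positive {suc n} f 0<sum with f zero in f0
... | suc _ = zero , subst (0 <_) (sym f0) (s≤s z≤n)
... | zero with i , 0<fi ← sum-positive (f ∘ suc) 0<sum = suc i , 0<fi

sum≤1 : ∀ {n} (f : Fin n → ℕ) → (∀ i → f i ≤ 1) → (∀ {i j} → 0 < f i → 0 < f j → i ≡ j) → sum f ≤ 1
sum≤1 {zero}  f f≤1 unique = z≤n
sum≤1 {suc n} f f≤1 unique with f zero ℕ.≟ 0
... | yes f0≡0 = subst (λ x → x + sum (f ∘ suc) ≤ 1) (sym f0≡0)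
                  (sum≤1 (f ∘ suc) (f≤1 ∘ suc) (λ p q → Data.Fin.Properties.suc-injective (unique p q)))
... | no f0≢0 = begin
  f zero + sum (f ∘ suc) ≡⟨ cong (f zero +_) (sum-zero rest≡0) ⟩
  f zero + 0             ≡⟨ +-identityʳ (f zero) ⟩
  f zero                 ≤⟨ f≤1 zero ⟩
  1                      ∎
  where
  open ≤-Reasoning
  rest≡0 : ∀ i → f (suc i) ≡ 0
  rest≡0 i with f (suc i) ℕ.≟ 0
  ... | yes fi≡0 = fi≡0
  ... | no fi≢0 with () ← unique (n≢0⇒n>0 f0≢0) (n≢0⇒n>0 fi≢0)

0<[b]⇒b : ∀ {b} → 0 < [ b ] → b ≡ true
0<[b]⇒b {true} _ = refl

sum-indicator≤1 : ∀ {n} (p : Fin n → Bool) → (∀ {i j} → p i ≡ true → p j ≡ true → i ≡ j) →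
                  ∑[ i < n ] [ p i ] ≤ 1
sum-indicator≤1 p unique = sum≤1 _ (λ i → [b]≤1 (p i)) (λ p q → unique (0<[b]⇒b p) (0<[b]⇒b q))

sum₂-indicator≤1 : ∀ {m n} (p : Fin m → Fin n → Bool) →
                   (∀ {a b a′ b′} → p a b ≡ true → p a′ b′ ≡ true → a ≡ a′ × b ≡ b′) →
                   ∑[ a < m ] ∑[ b < n ] [ p a b ] ≤ 1
sum₂-indicator≤1 {m} {n} p unique = sum≤1 _ row≤1 rows-unique
  where
  row≤1 : ∀ a → ∑[ b < n ] [ p a b ] ≤ 1
  row≤1 a = sum-indicator≤1 (p a) (λ q r → proj₂ (unique q r))
  rows-unique : ∀ {a a′} → 0 < ∑[ b < n ] [ p a b ] → 0 < ∑[ b < n ] [ p a′ b ] → a ≡ a′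
  rows-unique {a} {a′} q r
    with b , q′ ← sum-positive (λ b → [ p a b ]) q | b′ , r′ ← sum-positive (λ b → [ p a′ b ]) r =
    proj₁ (unique (0<[b]⇒b q′) (0<[b]⇒b r′))

all≤1∧sum≥n⇒all≥1 : ∀ {n} (f : Fin n → ℕ) → (∀ i → f i ≤ 1) → n ≤ sum f → ∀ i → 1 ≤ f i
all≤1∧sum≥n⇒all≥1 {n} f f≤1 n≤sum i with f i ℕ.≟ 0
... | no fi≢0  = n≢0⇒n>0 fi≢0
... | yes fi≡0 = contradiction n≤sum (<⇒≱ (subst (sum f <_) (sum-ones n)
                   (sum-mono-< f≤1 i (subst (_< 1) (sym fi≡0) (s≤s z≤n)))))

all≥1∧sum≤n⇒all≤1 : ∀ {n} (f : Fin n → ℕ) → (∀ i → 1 ≤ f i) → sum f ≤ n → ∀ i → f i ≤ 1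
all≥1∧sum≤n⇒all≤1 {n} f 1≤f sum≤n i with f i ℕ.≤? 1
... | yes fi≤1 = fi≤1
... | no fi≰1  = contradiction sum≤n (<⇒≱ (subst (_< sum f) (sum-ones n) (sum-mono-< 1≤f i (≰⇒> fi≰1))))

sum-select : ∀ {n} (v : Fin n) (f : Fin n → ℕ) → ∑[ a < n ] ([ ⌊ v ≟ a ⌋ ] * f a) ≡ f v
sum-select {suc n} zero f = begin
  f zero + 0 + sum (λ a → 0 * f (suc a)) ≡⟨ cong (f zero + 0 +_) (sum-zero {f = λ a → 0 * f (suc a)} λ _ → refl) ⟩
  f zero + 0 + 0                         ≡⟨ trans (+-identityʳ _) (+-identityʳ _) ⟩
  f zero                                 ∎
  where open ≡-Reasoning
sum-select {suc n} (suc v) f = trans (sum-cong-≗ shift) (sum-select v (f ∘ suc))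
  where
  shift : ∀ a → [ ⌊ suc v ≟ suc a ⌋ ] * f (suc a) ≡ [ ⌊ v ≟ a ⌋ ] * f (suc a)
  shift a with v ≟ a
  ... | yes _ = refl
  ... | no _  = refl

sum-select-indicator : ∀ {m} (p : Bool) (x : Fin m) → ∑[ j < m ] [ p ∧ ⌊ x ≟ j ⌋ ] ≡ [ p ]
sum-select-indicator p x = trans (sum-cong-≗ (λ j → [∧]≡* p ⌊ x ≟ j ⌋)) (sum-select x (λ _ → [ p ]))

odd : ℕ → Bool
odd zero    = false
odd (suc n) = not (odd n)

odd-+ : ∀ m n → odd (m + n) ≡ odd m xor odd n
odd-+ zero    n = refl
odd-+ (suc m) n = trans (cong not (odd-+ m n)) (Bool.not-distribˡ-xor (odd m) (odd n))

odd-* : ∀ m n → odd (m * n) ≡ odd m ∧ odd n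
odd-* zero    n = refl
odd-* (suc m) n = trans (odd-+ n (m * n)) (trans (cong (odd n xor_) (odd-* m n)) (xor-∧ (odd m) (odd n)))
  where
  xor-∧ : ∀ x y → y xor (x ∧ y) ≡ not x ∧ y
  xor-∧ true  true  = refl
  xor-∧ true  false = refl
  xor-∧ false y     = Bool.xor-identityʳ y

odd-double : ∀ m → odd (m + m) ≡ false
odd-double m = trans (odd-+ m m) (Bool.xor-same (odd m))

odd⇒positive : ∀ {m} → odd m ≡ true → 1 ≤ m
odd⇒positive {suc m} _ = s≤s z≤n

-- (2 + k) % 2 computes to k % 2.
Odd⇒odd : ∀ {k} → Odd k → odd k ≡ true
Odd⇒odd {suc zero}    _     = refl
Odd⇒odd {suc (suc k)} k%2≡1 = trans (Bool.not-involutive (odd k)) (Odd⇒odd {k} k%2≡1)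

sum₂-symmetric-even : ∀ {n} (f : Fin n → Fin n → ℕ) → (∀ a b → f a b ≡ f b a) → (∀ a → f a a ≡ 0) →
                      odd (∑[ a < n ] ∑[ b < n ] f a b) ≡ false
sum₂-symmetric-even {zero}  f f-sym f-diag = refl
sum₂-symmetric-even {suc n} f f-sym f-diag = begin
  odd (∑[ a < suc n ] ∑[ b < suc n ] f a b) ≡⟨ cong odd split ⟩
  odd (row + row + inner)                   ≡⟨ odd-+ (row + row) inner ⟩
  odd (row + row) xor odd inner             ≡⟨ cong₂ _xor_ (odd-double row) inner-even ⟩
  false                                     ∎
  where
  open ≡-Reasoning
  row   = ∑[ b < n ] f zero (suc b)
  inner = ∑[ a < n ] ∑[ b < n ] f (suc a) (suc b)
  inner-even : odd inner ≡ false
  inner-even = sum₂-symmetric-even (λ a b → f (suc a) (suc b)) (λ a b → f-sym (suc a) (suc b)) (f-diag ∘ suc)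
  split : ∑[ a < suc n ] ∑[ b < suc n ] f a b ≡ row + row + inner
  split = begin
    (f zero zero + row) + ∑[ a < n ] (f (suc a) zero + ∑[ b < n ] f (suc a) (suc b))
      ≡⟨ cong₂ _+_ (cong (_+ row) (f-diag zero)) (∑-distrib-+ (λ a → f (suc a) zero) _) ⟩
    row + (∑[ a < n ] f (suc a) zero + inner)
      ≡⟨ cong (λ column → row + (column + inner)) (sum-cong-≗ (λ a → f-sym (suc a) zero)) ⟩
    row + (row + inner)
      ≡⟨ +-assoc row row inner ⟨
    row + row + inner ∎

∑₂-distrib-+ : ∀ {m n} (f g : Fin m → Fin n → ℕ) →
               ∑[ a < m ] ∑[ b < n ] (f a b + g a b) ≡ ∑[ a < m ] ∑[ b < n ] f a b + ∑[ a < m ] ∑[ b < n ] g a b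
∑₂-distrib-+ f g = trans (sum-cong-≗ λ a → ∑-distrib-+ (f a) (g a))
                         (∑-distrib-+ (λ a → sum (f a)) (λ a → sum (g a)))

-- Vertex sets and boundaries

counterexample : ∀ {x b y : Bool} → ¬ (x ≡ true → y ≡ b) → x ≡ true × y ≡ not b
counterexample {false} x⇏y = contradiction (λ ()) x⇏y
counterexample {true}  x⇏y = refl , Bool.¬-not (λ y≡b → x⇏y (λ _ → y≡b))

VertexSet : ℕ → Set
VertexSet n = Fin n → Bool

module _ {n : ℕ} where

  ∁ : VertexSet n → VertexSet n
  ∁ X a = not (X a)

  infixr 7 _∩_
  infixr 6 _∪_ _∖_

  _∩_ _∪_ _∖_ : VertexSet n → VertexSet n → VertexSet n
  (X ∩ Y) a = X a ∧ Y a
  (X ∪ Y) a = X a ∨ Y a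
  (X ∖ Y) a = X a ∧ not (Y a)

  size : VertexSet n → ℕ
  size X = ∑[ a < n ] [ X a ]

  size-split : ∀ X Y → size X ≡ size (X ∩ Y) + size (X ∖ Y)
  size-split X Y = trans (sum-cong-≗ (λ a → split (X a) (Y a))) (∑-distrib-+ (λ a → [ (X ∩ Y) a ]) _)
    where
    split : ∀ x y → [ x ] ≡ [ x ∧ y ] + [ x ∧ not y ]
    split true  true  = refl
    split true  false = refl
    split false y     = refl

  _⊆_ Disjoint : VertexSet n → VertexSet n → Set
  X ⊆ Y      = ∀ a → X a ≡ true → Y a ≡ true
  Disjoint X Y = ∀ a → X a ≡ true → Y a ≡ false

  _⊆?_ : ∀ X Y → Dec (X ⊆ Y)
  X ⊆? Y = all? λ a → (X a Bool.≟ true) →-dec (Y a Bool.≟ true)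

  disjoint? : ∀ X Y → Dec (Disjoint X Y)
  disjoint? X Y = all? λ a → (X a Bool.≟ true) →-dec (Y a Bool.≟ false)

  ⊈⇒witness : ∀ {X Y} → ¬ X ⊆ Y → ∃ λ a → X a ≡ true × Y a ≡ false
  ⊈⇒witness {X} {Y} X⊈Y
    with a , escapes ← ¬∀⟶∃¬ n _ (λ a → (X a Bool.≟ true) →-dec (Y a Bool.≟ true)) X⊈Y
    = a , counterexample escapes

  non-disjoint⇒witness : ∀ {X Y} → ¬ Disjoint X Y → ∃ λ a → X a ≡ true × Y a ≡ true
  non-disjoint⇒witness {X} {Y} meet
    with a , escapes ← ¬∀⟶∃¬ n _ (λ a → (X a Bool.≟ true) →-dec (Y a Bool.≟ false)) meet
    = a , counterexample escapes

  ⋃ : List (VertexSet n) → VertexSet n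
  ⋃ []       a = false
  ⋃ (X ∷ Xs) a = X a ∨ ⋃ Xs a

  ⋃-⊇ : ∀ {X Xs} → Any (X ⊆_) Xs → X ⊆ ⋃ Xs
  ⋃-⊇ {Xs = Y ∷ _} (here X⊆Y) a Xa rewrite X⊆Y a Xa = refl
  ⋃-⊇ {Xs = Y ∷ _} (there X⊆⋃) a Xa rewrite ⋃-⊇ X⊆⋃ a Xa = Bool.∨-zeroʳ (Y a)

  ⋃-disjoint : ∀ {X Xs} → All (Disjoint X) Xs → Disjoint X (⋃ Xs)
  ⋃-disjoint []                     a Xa = refl
  ⋃-disjoint (X∩Y≡∅ ∷ X∩⋃Ys≡∅) a Xa = cong₂ _∨_ (X∩Y≡∅ a Xa) (⋃-disjoint X∩⋃Ys≡∅ a Xa)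

  ⋃-filter-outside : ∀ {X} Xs → All (λ Y → ¬ Disjoint X Y → Y ⊆ X) Xs →
                     ∀ {a} → X a ≡ false → ⋃ (filter (disjoint? X) Xs) a ≡ ⋃ Xs a
  ⋃-filter-outside []       []                 Xa = refl
  ⋃-filter-outside {X} (Y ∷ Ys) (meets⇒⊆ ∷ rest) {a} Xa with disjoint? X Y
  ... | yes disjoint rewrite filter-accept (disjoint? X) {xs = Ys} disjoint = cong (Y a ∨_) (⋃-filter-outside Ys rest Xa)
  ... | no meets rewrite filter-reject (disjoint? X) {xs = Ys} meets with Y a in Ya
  ...   | true  = contradiction (trans (sym (meets⇒⊆ meets a Ya)) Xa) λ ()
  ...   | false = ⋃-filter-outside Ys rest Xa

Adjacency : ℕ → Set
Adjacency n = Fin n → Fin n → Bool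

Symmetric Loopless : ∀ {n} → Adjacency n → Set
Symmetric e = ∀ a b → e a b ≡ e b a
Loopless  e = ∀ a → e a a ≡ false

module _ {n : ℕ} (e : Adjacency n) where

  deg : Fin n → ℕ
  deg a = ∑[ b < n ] [ e a b ]

  crossing : VertexSet n → Adjacency n
  crossing X a b = e a b ∧ X a ∧ not (X b)

  ∂ : VertexSet n → ℕ
  ∂ X = ∑[ a < n ] ∑[ b < n ] [ crossing X a b ]

  ∂-cong : ∀ {X Y} → X ≗ Y → ∂ X ≡ ∂ Y
  ∂-cong X≗Y = sum-cong-≗ λ a → sum-cong-≗ λ b → cong₂ (λ x y → [ e a b ∧ x ∧ not y ]) (X≗Y a) (X≗Y b)

  ∂-submodular : ∀ X Y → ∂ (X ∩ Y) + ∂ (X ∪ Y) ≤ ∂ X + ∂ Y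
  ∂-submodular X Y = begin
    ∂ (X ∩ Y) + ∂ (X ∪ Y)
      ≡⟨ ∑₂-distrib-+ (λ a b → [ crossing (X ∩ Y) a b ]) (λ a b → [ crossing (X ∪ Y) a b ]) ⟨
    ∑[ a < n ] ∑[ b < n ] ([ crossing (X ∩ Y) a b ] + [ crossing (X ∪ Y) a b ])
      ≤⟨ sum-mono-≤ (λ a → sum-mono-≤ λ b → pointwise (e a b) (X a) (Y a) (X b) (Y b)) ⟩
    ∑[ a < n ] ∑[ b < n ] ([ crossing X a b ] + [ crossing Y a b ])
      ≡⟨ ∑₂-distrib-+ (λ a b → [ crossing X a b ]) (λ a b → [ crossing Y a b ]) ⟩
    ∂ X + ∂ Y ∎
    where
    open ≤-Reasoning
    pointwise : ∀ z xa ya xb yb →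
      [ z ∧ (xa ∧ ya) ∧ not (xb ∧ yb) ] + [ z ∧ (xa ∨ ya) ∧ not (xb ∨ yb) ] ≤ [ z ∧ xa ∧ not xb ] + [ z ∧ ya ∧ not yb ]
    pointwise false _     _     _     _     = z≤n
    pointwise true  false false _     _     = z≤n
    pointwise true  true  true  true  true  = ≤ᵇ⇒≤ _ _ _
    pointwise true  true  true  true  false = ≤ᵇ⇒≤ _ _ _
    pointwise true  true  true  false true  = ≤ᵇ⇒≤ _ _ _
    pointwise true  true  true  false false = ≤ᵇ⇒≤ _ _ _
    pointwise true  true  false true  true  = ≤ᵇ⇒≤ _ _ _
    pointwise true  true  false true  false = ≤ᵇ⇒≤ _ _ _
    pointwise true  true  false false true  = ≤ᵇ⇒≤ _ _ _
    pointwise true  true  false false false = ≤ᵇ⇒≤ _ _ _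
    pointwise true  false true  true  true  = ≤ᵇ⇒≤ _ _ _
    pointwise true  false true  true  false = ≤ᵇ⇒≤ _ _ _
    pointwise true  false true  false true  = ≤ᵇ⇒≤ _ _ _
    pointwise true  false true  false false = ≤ᵇ⇒≤ _ _ _

  module _ (e-sym : Symmetric e) where

    ∂-complement : ∀ X → ∂ (∁ X) ≡ ∂ X
    ∂-complement X = trans (sum-cong-≗ λ a → sum-cong-≗ λ b → cong [_] (reverse a b))
                           (∑-comm (λ a b → [ crossing X b a ]))
      where
      reverse : ∀ a b → crossing (∁ X) a b ≡ crossing X b a
      reverse a b rewrite e-sym a b =
        cong (e b a ∧_) (trans (cong (not (X a) ∧_) (Bool.not-involutive (X b))) (Bool.∧-comm (not (X a)) (X b)))

    ∂-posimodular : ∀ X Y → ∂ (X ∖ Y) + ∂ (Y ∖ X) ≤ ∂ X + ∂ Y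
    ∂-posimodular X Y = begin
      ∂ (X ∖ Y) + ∂ (Y ∖ X)        ≡⟨ cong (∂ (X ∖ Y) +_) (trans (∂-cong de-Morgan) (∂-complement (X ∪ ∁ Y))) ⟩
      ∂ (X ∩ ∁ Y) + ∂ (X ∪ ∁ Y)    ≤⟨ ∂-submodular X (∁ Y) ⟩
      ∂ X + ∂ (∁ Y)                ≡⟨ cong (∂ X +_) (∂-complement Y) ⟩
      ∂ X + ∂ Y                    ∎
      where
      open ≤-Reasoning
      de-Morgan : Y ∖ X ≗ ∁ (X ∪ ∁ Y)
      de-Morgan a = de-Morgan-bool (X a) (Y a)
        where
        de-Morgan-bool : ∀ x y → y ∧ not x ≡ not (x ∨ not y)
        de-Morgan-bool true  y = Bool.∧-zeroʳ y
        de-Morgan-bool false y = trans (Bool.∧-identityʳ y) (sym (Bool.not-involutive y))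

    module _ (e-loopless : Loopless e) where

      degrees-even : odd (∑[ a < n ] deg a) ≡ false
      degrees-even = sum₂-symmetric-even (λ a b → [ e a b ]) (λ a b → cong [_] (e-sym a b)) (λ a → cong [_] (e-loopless a))

      odd-∑deg≡odd-∂ : ∀ X → odd (∑[ a < n ] ([ X a ] * deg a)) ≡ odd (∂ X)
      odd-∑deg≡odd-∂ X = begin
        odd (∑[ a < n ] ([ X a ] * deg a))   ≡⟨ cong odd split ⟩
        odd (inside + ∂ X)                   ≡⟨ odd-+ inside (∂ X) ⟩
        odd inside xor odd (∂ X)             ≡⟨ cong (_xor odd (∂ X)) inside-even ⟩
        odd (∂ X)                            ∎
        where
        open ≡-Reasoning
        within : Adjacency n
        within a b = e a b ∧ X a ∧ X b
        inside = ∑[ a < n ] ∑[ b < n ] [ within a b ]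
        inside-even : odd inside ≡ false
        inside-even = sum₂-symmetric-even (λ a b → [ within a b ]) within-sym (λ a → cong (λ z → [ z ∧ X a ∧ X a ]) (e-loopless a))
          where
          within-sym : ∀ a b → [ within a b ] ≡ [ within b a ]
          within-sym a b = cong [_] (cong₂ _∧_ (e-sym a b) (Bool.∧-comm (X a) (X b)))
        split-term : ∀ z x y → [ x ] * [ z ] ≡ [ z ∧ x ∧ y ] + [ z ∧ x ∧ not y ]
        split-term true  true  true  = refl
        split-term true  true  false = refl
        split-term true  false y     = refl
        split-term false true  y     = refl
        split-term false false y     = refl
        split : ∑[ a < n ] ([ X a ] * deg a) ≡ inside + ∂ X
        split = trans (sum-cong-≗ λ a → trans (*-distribˡ-sum [ X a ] (λ b → [ e a b ]))
                        (sum-cong-≗ λ b → split-term (e a b) (X a) (X b)))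
                      (∑₂-distrib-+ (λ a b → [ within a b ]) (λ a b → [ crossing X a b ]))

crossing-parts : ∀ {n} {e : Adjacency n} {X a b} → crossing e X a b ≡ true → e a b ≡ true × X a ≡ true × X b ≡ false
crossing-parts {e = e} {X} {a} {b} crosses with e a b | X a | X b
... | true | true | false = refl , refl , refl

-- Cuts and components of a graph

length-filterᵇ-tabulate : ∀ {n} {A : Set} (p : A → Bool) (f : Fin n → A) →
                          length (filterᵇ p (tabulate f)) ≡ ∑[ i < n ] [ p (f i) ]
length-filterᵇ-tabulate {zero}  p f = refl
length-filterᵇ-tabulate {suc n} p f with p (f zero)
... | true  = cong suc (length-filterᵇ-tabulate p (f ∘ suc))
... | false = length-filterᵇ-tabulate p (f ∘ suc)

length-concatMap-tabulate : ∀ {n} {A B : Set} (g : A → List B) (f : Fin n → A) →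
                            length (concatMap g (tabulate f)) ≡ ∑[ i < n ] length (g (f i))
length-concatMap-tabulate {zero}  g f = refl
length-concatMap-tabulate {suc n} g f =
  trans (length-++ (g (f zero))) (cong (length (g (f zero)) +_) (length-concatMap-tabulate g (f ∘ suc)))

⌊≟⌋-refl : ∀ {n} (a : Fin n) → ⌊ a ≟ a ⌋ ≡ true
⌊≟⌋-refl a = trans (isYes≗does (a ≟ a)) (dec-true (a ≟ a) refl)

sameEdge-refl : ∀ {n} (e : Edge n) → T (sameEdge e e)
sameEdge-refl (a , b) rewrite ⌊≟⌋-refl a | ⌊≟⌋-refl b = _

sameEdge-sound : ∀ {n} {a b c d : Fin n} → T (sameEdge (a , b) (c , d)) → (a ≡ c × b ≡ d) ⊎ (a ≡ d × b ≡ c)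
sameEdge-sound {a = a} {b} {c} {d} same with a ≟ c | b ≟ d | a ≟ d | b ≟ c
... | yes a≡c | yes b≡d | _      | _      = inj₁ (a≡c , b≡d)
... | yes _   | no _    | yes a≡d | yes b≡c = inj₂ (a≡d , b≡c)
... | no _    | _       | yes a≡d | yes b≡c = inj₂ (a≡d , b≡c)
... | yes _   | no _    | yes _  | no _   = contradiction same λ ()
... | yes _   | no _    | no _   | _      = contradiction same λ ()
... | no _    | _       | yes _  | no _   = contradiction same λ ()
... | no _    | _       | no _   | _      = contradiction same λ ()

∈⇒inEdgeList : ∀ {n} {e : Edge n} {F} → e ∈ F → inEdgeList e F ≡ true
∈⇒inEdgeList {e = e} e∈F = Equivalence.to Bool.T-≡ (any⁺ _ (Any.map (λ { refl → sameEdge-refl e }) e∈F))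

module _ {n : ℕ} (G : Graph n) where

  degree≡deg : ∀ v → degree G v ≡ deg (adj G) v
  degree≡deg v = length-filterᵇ-tabulate (adj G v) id

  regular⇒deg≡ : ∀ {k} → Regular k G → ∀ v → deg (adj G) v ≡ k
  regular⇒deg≡ regular v = trans (sym (degree≡deg v)) (regular v)

  Reach-snoc : ∀ {F u a w} → Reach G F u a → adj G a w ≡ true → inEdgeList (a , w) F ≡ false → Reach G F u w
  Reach-snoc here           aw aw∉F = step aw aw∉F here
  Reach-snoc (step ub ub∉F r) aw aw∉F = step ub ub∉F (Reach-snoc r aw aw∉F)

  cutEdgesFrom : VertexSet n → Fin n → List (Edge n)
  cutEdgesFrom X a = map (a ,_) (filterᵇ (crossing (adj G) X a) (allFin n))

  cutEdges : VertexSet n → List (Edge n)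
  cutEdges X = concatMap (cutEdgesFrom X) (allFin n)

  length-cutEdges : ∀ X → length (cutEdges X) ≡ ∂ (adj G) X
  length-cutEdges X = trans (length-concatMap-tabulate (cutEdgesFrom X) id) (sum-cong-≗ λ a →
    trans (length-map (a ,_) (filterᵇ (crossing (adj G) X a) (allFin n)))
          (length-filterᵇ-tabulate (crossing (adj G) X a) id))

  crossing⇒∈cutEdges : ∀ X {a b} → crossing (adj G) X a b ≡ true → (a , b) ∈ cutEdges X
  crossing⇒∈cutEdges X {a} {b} ab-crosses = ∈-concatMap⁺ _ (lose (∈-allFin a)
    (∈-map⁺ (a ,_) (∈-filter⁺ (Bool.T? ∘ crossing (adj G) X a) (∈-allFin b) (Equivalence.from Bool.T-≡ ab-crosses))))

  cutEdges-separate : ∀ X {a b} → Reach G (cutEdges X) a b → X a ≡ true → X b ≡ false → ⊥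
  cutEdges-separate X here Xa Xb = contradiction (trans (sym Xa) Xb) λ ()
  cutEdges-separate X {a} (step {w = w} aw aw∉cut r) Xa Xb with X w in Xw
  ... | true  = cutEdges-separate X r Xw Xb
  ... | false = contradiction (trans (sym aw∉cut) (∈⇒inEdgeList (crossing⇒∈cutEdges X aw-crosses))) λ ()
    where
    aw-crosses : crossing (adj G) X a w ≡ true
    aw-crosses rewrite aw | Xa | Xw = refl

  ∂-lower-bound : ∀ {k} → EdgeConnected k G → ∀ X {a b} → X a ≡ true → X b ≡ false → k ≤ ∂ (adj G) X
  ∂-lower-bound {k} (_ , connected) X {a} {b} Xa Xb with k ≤? ∂ (adj G) X
  ... | yes k≤∂ = k≤∂
  ... | no k≰∂  = contradiction (connected (cutEdges X) (subst (_< k) (sym (length-cutEdges X)) (≰⇒> k≰∂)) a b)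
                    λ r → cutEdges-separate X r Xa Xb

BoundaryIn : ∀ {n} (G : Graph n) → VertexSet n → List (Edge n) → Set
BoundaryIn G X F = ∀ {a b} → crossing (adj G) X a b ≡ true → inEdgeList (a , b) F ≡ true

module Component {n : ℕ} (G : Graph n) (F : List (Edge n)) (u : Fin n) where

  kept : Adjacency n
  kept a w = adj G a w ∧ not (inEdgeList (a , w) F)

  grow : VertexSet n → VertexSet n
  grow X w = X w ∨ any (λ a → X a ∧ kept a w) (allFin n)

  grow-cong : ∀ {X Y} → X ≗ Y → grow X ≗ grow Y
  grow-cong X≗Y w = cong₂ _∨_ (X≗Y w) (cong or (map-cong (λ a → cong (_∧ kept a w) (X≗Y a)) (allFin n)))

  grow-inflationary : ∀ X {w} → X w ≡ true → grow X w ≡ true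
  grow-inflationary X Xw rewrite Xw = refl

  grow-step : ∀ X {a w} → X a ≡ true → kept a w ≡ true → grow X w ≡ true
  grow-step X {a} {w} Xa aw-kept = trans (cong (X w ∨_) (Equivalence.to Bool.T-≡
    (any⁺ _ (lose (∈-allFin a) (Equivalence.from Bool.T-≡ (cong₂ _∧_ Xa aw-kept))))))
    (Bool.∨-zeroʳ (X w))

  size-grow : ∀ X → ¬ (grow X ≗ X) → size X < size (grow X)
  size-grow X not-closed with w , grows ← ¬∀⟶∃¬ n _ (λ w → grow X w Bool.≟ X w) not-closed =
    sum-mono-< (λ a → indicator-mono (grow-inflationary X)) w (strict (X w) (grow-inflationary X) grows)
    where
    indicator-mono : ∀ {x y} → (x ≡ true → y ≡ true) → [ x ] ≤ [ y ]
    indicator-mono {false}     _   = z≤n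
    indicator-mono {true}  x⇒y rewrite x⇒y refl = ≤-refl
    strict : ∀ x {y} → (x ≡ true → y ≡ true) → y ≢ x → [ x ] < [ y ]
    strict true  x⇒y y≢x = contradiction (x⇒y refl) y≢x
    strict false {true}  _ _   = s≤s z≤n
    strict false {false} _ y≢x = contradiction refl y≢x

  ball : ℕ → VertexSet n
  ball zero    w = ⌊ u ≟ w ⌋
  ball (suc t)   = grow (ball t)

  ball-large-or-closed : ∀ t → t ≤ size (ball t) ⊎ grow (ball t) ≗ ball t
  ball-large-or-closed zero = inj₁ z≤n
  ball-large-or-closed (suc t) with all? (λ w → grow (ball (suc t)) w Bool.≟ ball (suc t) w)
  ... | yes closed   = inj₂ closed
  ... | no not-closed = inj₁ (≤-trans (s≤s t≤size) (size-grow (ball t) (not-closed ∘ grow-cong)))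
    where
    t≤size : t ≤ size (ball t)
    t≤size = [ (λ t≤ → t≤) , (λ closed → contradiction (grow-cong closed) not-closed) ]′ (ball-large-or-closed t)

  component : VertexSet n
  component = ball (suc n)

  component-closed : grow component ≗ component
  component-closed = [ (λ large → contradiction large (<⇒≱ (s≤s (size≤n component)))) , (λ closed → closed) ]′
                       (ball-large-or-closed (suc n))
    where
    size≤n : ∀ X → size X ≤ n
    size≤n X = subst (size X ≤_) (sum-ones n) (sum-mono-≤ (λ a → [b]≤1 (X a)))

  ball-source : ∀ t → ball t u ≡ true
  ball-source zero    = ⌊≟⌋-refl u
  ball-source (suc t) = grow-inflationary (ball t) (ball-source t)

  ball-reachable : ∀ t {w} → ball t w ≡ true → Reach G F u w
  ball-reachable zero {w} uw with u ≟ w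
  ... | yes refl = here
  ball-reachable (suc t) {w} in-ball with Equivalence.to Bool.T-∨ (Equivalence.from Bool.T-≡ in-ball)
  ... | inj₁ in-previous = ball-reachable t (Equivalence.to Bool.T-≡ in-previous)
  ... | inj₂ reached-from with a , a-ok ← satisfied (any⁻ _ (allFin n) reached-from)
    with a-in , aw-kept ← Equivalence.to Bool.T-∧ a-ok
    with aw , aw∉F ← Equivalence.to Bool.T-∧ aw-kept =
    Reach-snoc G (ball-reachable t (Equivalence.to Bool.T-≡ a-in))
                 (Equivalence.to Bool.T-≡ aw) (Equivalence.to Bool.T-not-≡ aw∉F)

  component-source : component u ≡ true
  component-source = ball-source (suc n)

  component-reachable : ∀ {w} → component w ≡ true → Reach G F u w
  component-reachable = ball-reachable (suc n)

  component-boundary : BoundaryIn G component F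
  component-boundary {a} {b} ab-crosses with inEdgeList (a , b) F Bool.≟ true
  ... | yes ab∈F = ab∈F
  ... | no ab∉F = contradiction (trans (sym (component-closed b)) (grow-step component a-in ab-kept)) (Bool.not-¬ b-out)
    where
    parts = crossing-parts {e = adj G} {component} ab-crosses
    a-in  = proj₁ (proj₂ parts)
    b-out = proj₂ (proj₂ parts)
    ab-kept : kept a b ≡ true
    ab-kept rewrite proj₁ parts | Bool.¬-not ab∉F = refl

SeparatingSet : ∀ {n} (G : Graph n) → List (Edge n) → Fin n → Fin n → VertexSet n → Set
SeparatingSet G F u v X = X u ≡ true × X v ≡ false × BoundaryIn G X F

unreachable⇒separatingSet : ∀ {n} (G : Graph n) {F u v} → ¬ Reach G F u v → ∃ (SeparatingSet G F u v)
unreachable⇒separatingSet G {F} {u} {v} u↛v = component , component-source , v-out , component-boundary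
  where
  open Component G F u
  v-out : component v ≡ false
  v-out with component v in v-in
  ... | true  = contradiction (component-reachable v-in) u↛v
  ... | false = refl

distinct⇒length≤ : ∀ {m} (xs : List (Fin m)) → AllPairs _≢_ xs → length xs ≤ m
distinct⇒length≤ xs distinct = injective⇒≤ (lookup-injective distinct)
  where
  lookup-injective : ∀ {xs} → AllPairs _≢_ xs → ∀ {i j} → lookup xs i ≡ lookup xs j → i ≡ j
  lookup-injective (_ ∷ _)      {zero}  {zero}  _   = refl
  lookup-injective (x∉ ∷ _)     {zero}  {suc j} x≡ = contradiction x≡ (All.lookup x∉ (∈-lookup j))
  lookup-injective (x∉ ∷ _)     {suc i} {zero}  ≡x = contradiction (sym ≡x) (All.lookup x∉ (∈-lookup i))
  lookup-injective (_ ∷ rest)   {suc i} {suc j} eq = cong suc (lookup-injective rest eq)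

-- Edge-colourings

image-absent : ∀ {A B : Set} {P : A → Set} (f : A → B) {x y xs} → All (f x ≢_) (map f xs) → f x ≡ y →
               ¬ Any (λ z → P z × f z ≡ y) xs
image-absent f fx∉ fx≡y =
  All.All¬⇒¬Any (All.map (λ fx≢fz (_ , fz≡y) → fx≢fz (trans fx≡y (sym fz≡y))) (All.map⁻ fx∉))

distinct-images⇒unique : ∀ {A B : Set} {P Q : A → Set} (f : A → B) {y} {xs} → AllPairs _≢_ (map f xs) →
                         Any (λ x → P x × f x ≡ y) xs → Any (λ x → Q x × f x ≡ y) xs → ∃ λ x → P x × Q x
distinct-images⇒unique f {xs = x ∷ _} _   (here (p , _))    (here (q , _))    = x , p , q
distinct-images⇒unique f (fx∉ ∷ _)        (here (_ , fx≡y)) (there qs)        = contradiction qs (image-absent f fx∉ fx≡y)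
distinct-images⇒unique f (fx∉ ∷ _)        (there ps)        (here (_ , fx≡y)) = contradiction ps (image-absent f fx∉ fx≡y)
distinct-images⇒unique f (_ ∷ distinct)   (there ps)        (there qs)        = distinct-images⇒unique f distinct ps qs

AllPairs-strengthen : ∀ {A : Set} {P : A → Set} {R S : A → A → Set} →
                      (∀ {x y} → P x → P y → R x y → S x y) → ∀ {xs} → All P xs → AllPairs R xs → AllPairs S xs
AllPairs-strengthen strengthen []         []           = []
AllPairs-strengthen strengthen (px ∷ pxs) (rx ∷ rxs) =
  All.zipWith (λ (py , rxy) → strengthen px py rxy) (pxs , rx) ∷ AllPairs-strengthen strengthen pxs rxs

module Colouring {n m : ℕ} {G : Graph n} (c : EdgeColouring G m) where

  colour : Edge n → Fin m
  colour e = col c (proj₁ e) (proj₂ e)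

  colourClass : Fin m → Adjacency n
  colourClass j a b = adj G a b ∧ ⌊ col c a b ≟ j ⌋

  colourClass-parts : ∀ {j a b} → colourClass j a b ≡ true → adj G a b ≡ true × col c a b ≡ j
  colourClass-parts {j} {a} {b} ab-in with adj G a b | col c a b ≟ j
  ... | true | yes col≡j = refl , col≡j

  colourClass-sym : ∀ j → Symmetric (colourClass j)
  colourClass-sym j a b = cong₂ (λ x y → x ∧ ⌊ y ≟ j ⌋) (Graph.sym G a b) (colSym c a b)

  colourClass-loopless : ∀ j → Loopless (colourClass j)
  colourClass-loopless j a rewrite irrefl G a = refl

  split-by-colour : ∀ a b q → [ adj G a b ∧ q ] ≡ ∑[ j < m ] [ colourClass j a b ∧ q ]
  split-by-colour a b q = sym (trans (sum-cong-≗ λ j → cong [_] (reorder (adj G a b) ⌊ col c a b ≟ j ⌋ q))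
                                     (sum-select-indicator (adj G a b ∧ q) (col c a b)))
    where
    reorder : ∀ x y z → (x ∧ y) ∧ z ≡ (x ∧ z) ∧ y
    reorder x y z = trans (Bool.∧-assoc x y z) (trans (cong (x ∧_) (Bool.∧-comm y z)) (sym (Bool.∧-assoc x z y)))

  deg≡∑colourDeg : ∀ v → deg (adj G) v ≡ ∑[ j < m ] deg (colourClass j) v
  deg≡∑colourDeg v = begin
    ∑[ b < n ] [ adj G v b ]
      ≡⟨ sum-cong-≗ (λ b → cong [_] (Bool.∧-identityʳ (adj G v b))) ⟨
    ∑[ b < n ] [ adj G v b ∧ true ]
      ≡⟨ sum-cong-≗ (λ b → split-by-colour v b true) ⟩
    ∑[ b < n ] ∑[ j < m ] [ colourClass j v b ∧ true ]
      ≡⟨ ∑-comm (λ b j → [ colourClass j v b ∧ true ]) ⟩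
    ∑[ j < m ] ∑[ b < n ] [ colourClass j v b ∧ true ]
      ≡⟨ sum-cong-≗ (λ j → sum-cong-≗ λ b → cong [_] (Bool.∧-identityʳ (colourClass j v b))) ⟩
    ∑[ j < m ] deg (colourClass j) v ∎
    where open ≡-Reasoning

  ∂≡∑colour∂ : ∀ X → ∂ (adj G) X ≡ ∑[ j < m ] ∂ (colourClass j) X
  ∂≡∑colour∂ X = begin
    ∑[ a < n ] ∑[ b < n ] [ crossing (adj G) X a b ]
      ≡⟨ sum-cong-≗ (λ a → sum-cong-≗ λ b → split-by-colour a b _) ⟩
    ∑[ a < n ] ∑[ b < n ] ∑[ j < m ] [ crossing (colourClass j) X a b ]
      ≡⟨ sum-cong-≗ (λ a → ∑-comm (λ b j → [ crossing (colourClass j) X a b ])) ⟩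
    ∑[ a < n ] ∑[ j < m ] ∑[ b < n ] [ crossing (colourClass j) X a b ]
      ≡⟨ ∑-comm (λ a j → ∑[ b < n ] [ crossing (colourClass j) X a b ]) ⟩
    ∑[ j < m ] ∂ (colourClass j) X ∎
    where open ≡-Reasoning

  proper⇒colourDeg≤1 : Proper c → ∀ j v → deg (colourClass j) v ≤ 1
  proper⇒colourDeg≤1 proper j v = sum-indicator≤1 (colourClass j v) same-colour⇒same
    where
    same-colour⇒same : ∀ {w w′} → colourClass j v w ≡ true → colourClass j v w′ ≡ true → w ≡ w′
    same-colour⇒same {w} {w′} vw vw′ with w ≟ w′ | colourClass-parts vw | colourClass-parts vw′
    ... | yes w≡w′ | _ | _ = w≡w′
    ... | no w≢w′ | adj-w , col-w | adj-w′ , col-w′ =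
      contradiction (trans col-w (sym col-w′)) (proper v w w′ w≢w′ adj-w adj-w′)

  colourDeg≤1⇒proper : (∀ j v → deg (colourClass j) v ≤ 1) → Proper c
  colourDeg≤1⇒proper colourDeg≤1 v w w′ w≢w′ adj-w adj-w′ same-colour = <⇒≱ (s≤s (s≤s z≤n)) (begin
    2                                                     ≡⟨ cong₂ _+_ (in-class adj-w refl) (in-class adj-w′ (sym same-colour)) ⟨
    [ colourClass j v w ] + [ colourClass j v w′ ]        ≤⟨ two-terms≤sum (λ b → [ colourClass j v b ]) w≢w′ ⟩
    deg (colourClass j) v                                  ≤⟨ colourDeg≤1 j v ⟩
    1                                                      ∎)
    where
    open ≤-Reasoning
    j = col c v w
    in-class : ∀ {b} → adj G v b ≡ true → col c v b ≡ j → [ colourClass j v b ] ≡ 1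
    in-class {b} vb col≡j rewrite vb | col≡j | ⌊≟⌋-refl j = refl

  Rainbow : List (Edge n) → Set
  Rainbow R = AllPairs _≢_ (map colour R)

  rainbow⇒length≤ : ∀ {R} → Rainbow R → length R ≤ m
  rainbow⇒length≤ {R} rainbow = subst (_≤ m) (length-map colour R) (distinct⇒length≤ _ rainbow)

  rainbow⇒colour∂≤1 : ∀ {R X} → Rainbow R → BoundaryIn G X R → ∀ j → ∂ (colourClass j) X ≤ 1
  rainbow⇒colour∂≤1 {R} {X} rainbow ∂X⊆R j = sum₂-indicator≤1 (crossing (colourClass j) X) same-colour⇒same
    where
    in-X  : ∀ {a b} → crossing (colourClass j) X a b ≡ true → X a ≡ true
    in-X  = proj₁ ∘ proj₂ ∘ crossing-parts {e = colourClass j} {X}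
    out-X : ∀ {a b} → crossing (colourClass j) X a b ≡ true → X b ≡ false
    out-X = proj₂ ∘ proj₂ ∘ crossing-parts {e = colourClass j} {X}
    listed : ∀ {a b} → crossing (colourClass j) X a b ≡ true → Any (λ r → T (sameEdge (a , b) r) × colour r ≡ j) R
    listed {a} {b} ab-crosses
      with ab , a-in , b-out ← crossing-parts {e = colourClass j} {X} ab-crosses
      with adj-ab , col-ab ← colourClass-parts ab
      = Any.map with-colour (any⁻ _ R (Equivalence.from Bool.T-≡ (∂X⊆R ab-crosses-G)))
      where
      ab-crosses-G : crossing (adj G) X a b ≡ true
      ab-crosses-G rewrite adj-ab | a-in | b-out = refl
      with-colour : ∀ {r} → T (sameEdge (a , b) r) → T (sameEdge (a , b) r) × colour r ≡ j
      with-colour {x , y} same with sameEdge-sound {a = a} {b} {x} {y} same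
      ... | inj₁ (refl , refl) = same , col-ab
      ... | inj₂ (refl , refl) = same , trans (colSym c b a) col-ab
    same-colour⇒same : ∀ {a b a′ b′} → crossing (colourClass j) X a b ≡ true → crossing (colourClass j) X a′ b′ ≡ true →
                       a ≡ a′ × b ≡ b′
    same-colour⇒same {a} {b} {a′} {b′} ab a′b′
      with (x , y) , same , same′ ← distinct-images⇒unique colour rainbow (listed ab) (listed a′b′)
      with sameEdge-sound {a = a} {b} {x} {y} same | sameEdge-sound {a = a′} {b′} {x} {y} same′
    ... | inj₁ (refl , refl) | inj₁ (refl , refl) = refl , refl
    ... | inj₂ (refl , refl) | inj₂ (refl , refl) = refl , refl
    ... | inj₁ (refl , refl) | inj₂ (refl , refl) = contradiction (trans (sym (in-X ab)) (out-X a′b′)) λ ()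
    ... | inj₂ (refl , refl) | inj₁ (refl , refl) = contradiction (trans (sym (in-X a′b′)) (out-X ab)) λ ()

  star : Fin n → List (Edge n)
  star u = map (u ,_) (filterᵇ (adj G u) (allFin n))

  neighbours-adjacent : ∀ u → All (λ w → adj G u w ≡ true) (filterᵇ (adj G u) (allFin n))
  neighbours-adjacent u = All.map (Equivalence.to Bool.T-≡) (All.all-filter (Bool.T? ∘ adj G u) (allFin n))

  star-edges : ∀ u → All (IsEdge G) (star u)
  star-edges u = All.map⁺ (neighbours-adjacent u)

  star-rainbow : Proper c → ∀ u → Rainbow (star u)
  star-rainbow proper u = AllPairs.map⁺ (AllPairs.map⁺ (AllPairs-strengthen (λ uw uw′ w≢w′ → proper u _ _ w≢w′ uw uw′)
    (neighbours-adjacent u) (Unique.filter⁺ (Bool.T? ∘ adj G u) (Unique.allFin⁺ n))))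

  star-isolates : ∀ {u v} → u ≢ v → ¬ Reach G (star u) u v
  star-isolates u≢v here = u≢v refl
  star-isolates {u} u≢v (step {w = w} uw uw∉star _) = contradiction (trans (sym uw∈star) uw∉star) λ ()
    where
    uw∈star : inEdgeList (u , w) (star u) ≡ true
    uw∈star = ∈⇒inEdgeList (∈-map⁺ (u ,_) (∈-filter⁺ (Bool.T? ∘ adj G u) (∈-allFin w) (Equivalence.from Bool.T-≡ uw)))

  proper⇒rainbowDisconnected : Proper c → RainbowDisconnected c
  proper⇒rainbowDisconnected proper u v u≢v = star u , star-edges u , star-rainbow proper u , star-isolates u≢v

-- Odd, regular, highly edge-connected graphs

squeeze : ∀ {k x y} → k ≤ x → k ≤ y → x + y ≤ k + k → x ≡ k
squeeze {k} {x} {y} k≤x k≤y x+y≤2k = ≤-antisym (+-cancelʳ-≤ k x k (≤-trans (+-monoʳ-≤ x k≤y) x+y≤2k)) k≤x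

module OddRegular {n k : ℕ} {G : Graph n} (odd-k : odd k ≡ true)
                  (connected : EdgeConnected k G) (regular : Regular k G) where

  cut : VertexSet n → ℕ
  cut = ∂ (adj G)

  deg≡k : ∀ a → deg (adj G) a ≡ k
  deg≡k = regular⇒deg≡ G regular

  odd-*k : ∀ m → odd (m * k) ≡ odd m
  odd-*k m = trans (odd-* m k) (trans (cong (odd m ∧_) odd-k) (Bool.∧-identityʳ (odd m)))

  order-even : odd n ≡ false
  order-even = begin
    odd n                      ≡⟨ odd-*k n ⟨
    odd (n * k)                ≡⟨ cong odd (trans (sum-cong-≗ deg≡k) (sum-const n k)) ⟨
    odd (∑[ a < n ] deg (adj G) a) ≡⟨ degrees-even (adj G) (Graph.sym G) (irrefl G) ⟩
    false                      ∎
    where open ≡-Reasoning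

  Tight : VertexSet n → Set
  Tight X = cut X ≡ k

  tight⇒odd-size : ∀ {X} → Tight X → odd (size X) ≡ true
  tight⇒odd-size {X} tight = begin
    odd (size X)                          ≡⟨ odd-*k (size X) ⟨
    odd (size X * k)                      ≡⟨ cong odd (*-distribʳ-sum k (λ a → [ X a ])) ⟩
    odd (∑[ a < n ] ([ X a ] * k))        ≡⟨ cong odd (sum-cong-≗ λ a → cong ([ X a ] *_) (deg≡k a)) ⟨
    odd (∑[ a < n ] ([ X a ] * deg (adj G) a)) ≡⟨ odd-∑deg≡odd-∂ (adj G) (Graph.sym G) (irrefl G) X ⟩
    odd (cut X)                           ≡⟨ cong odd tight ⟩
    odd k                                 ≡⟨ odd-k ⟩
    true                                  ∎
    where open ≡-Reasoning

  tight-sets-do-not-cross : ∀ {X Y a₀ a b w} → Tight X → Tight Y →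
    X a₀ ≡ true → Y a₀ ≡ true → X a ≡ true → Y a ≡ false → Y b ≡ true → X b ≡ false → X w ≡ false → Y w ≡ false → ⊥
  tight-sets-do-not-cross {X} {Y} {a₀} {a} {b} {w} tight-X tight-Y Xa₀ Ya₀ Xa Ya Yb Xb Xw Yw =
    contradiction (begin
      true                                      ≡⟨ tight⇒odd-size tight-X ⟨
      odd (size X)                              ≡⟨ cong odd (size-split X Y) ⟩
      odd (size (X ∩ Y) + size (X ∖ Y))         ≡⟨ odd-+ (size (X ∩ Y)) (size (X ∖ Y)) ⟩
      odd (size (X ∩ Y)) xor odd (size (X ∖ Y)) ≡⟨ cong₂ _xor_ (tight⇒odd-size tight-∩) (tight⇒odd-size tight-∖) ⟩
      false                                     ∎) λ ()
    where
    open ≡-Reasoning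
    bound = ∂-lower-bound G connected
    sum≡2k : cut X + cut Y ≡ k + k
    sum≡2k = cong₂ _+_ tight-X tight-Y
    ∧≡false : ∀ x {y} → y ≡ false → x ∧ y ≡ false
    ∧≡false x refl = Bool.∧-zeroʳ x
    tight-∩ : Tight (X ∩ Y)
    tight-∩ = squeeze (bound (X ∩ Y) (cong₂ _∧_ Xa₀ Ya₀) (∧≡false (X a) Ya))
                      (bound (X ∪ Y) (cong (_∨ Y a₀) Xa₀) (cong₂ _∨_ Xw Yw))
                      (subst (cut (X ∩ Y) + cut (X ∪ Y) ≤_) sum≡2k (∂-submodular (adj G) X Y))
    tight-∖ : Tight (X ∖ Y)
    tight-∖ = squeeze (bound (X ∖ Y) (cong₂ _∧_ Xa (cong not Ya)) (∧≡false (X a₀) (cong not Ya₀)))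
                      (bound (Y ∖ X) (cong₂ _∧_ Yb (cong not Xb)) (∧≡false (Y a₀) (cong not Xa₀)))
                      (subst (cut (X ∖ Y) + cut (Y ∖ X) ≤_) sum≡2k (∂-posimodular (adj G) (Graph.sym G) X Y))

module OddColourDegree {n k : ℕ} {G : Graph n} (odd-k : odd k ≡ true)
                       (connected : EdgeConnected k G) (regular : Regular k G)
                       (c : EdgeColouring G k) (rd : RainbowDisconnected c) (v : Fin n) (j : Fin k) where

  open OddRegular odd-k connected regular
  open Colouring c

  record Shore (X : VertexSet n) : Set where
    field
      excludes-v : X v ≡ false
      tight      : Tight X
      one-j-edge : ∂ (colourClass j) X ≡ 1

  shore-around : ∀ {u} → u ≢ v → ∃ λ X → Shore X × X u ≡ true
  shore-around {u} u≢v
    with R , _ , rainbow , u↛v ← rd u v u≢v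
    with X , Xu , Xv , ∂X⊆R ← unreachable⇒separatingSet G u↛v
    = X , record { excludes-v = Xv
                 ; tight      = ≤-antisym cut≤k k≤cut
                 ; one-j-edge = ≤-antisym (colour∂≤1 j) (colour∂≥1 j) } , Xu
    where
    colour∂≤1 : ∀ i → ∂ (colourClass i) X ≤ 1
    colour∂≤1 = rainbow⇒colour∂≤1 {R} {X} rainbow ∂X⊆R
    k≤cut : k ≤ cut X
    k≤cut = ∂-lower-bound G connected X Xu Xv
    cut≤k : cut X ≤ k
    cut≤k = subst₂ _≤_ (sym (∂≡∑colour∂ X)) (sum-ones k) (sum-mono-≤ colour∂≤1)
    colour∂≥1 : ∀ i → 1 ≤ ∂ (colourClass i) X
    colour∂≥1 = all≤1∧sum≥n⇒all≥1 (λ i → ∂ (colourClass i) X) colour∂≤1 (subst (k ≤_) (∂≡∑colour∂ X) k≤cut)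

  shores-laminar : ∀ {X Y} → Shore X → Shore Y → ¬ Disjoint X Y → X ⊆ Y ⊎ Y ⊆ X
  shores-laminar {X} {Y} shore-X shore-Y meet with X ⊆? Y | Y ⊆? X
  ... | yes X⊆Y | _       = inj₁ X⊆Y
  ... | no _    | yes Y⊆X = inj₂ Y⊆X
  ... | no X⊈Y  | no Y⊈X
    with a₀ , Xa₀ , Ya₀ ← non-disjoint⇒witness meet
    with a , Xa , Ya ← ⊈⇒witness X⊈Y
    with b , Yb , Xb ← ⊈⇒witness Y⊈X
    = ⊥-elim (tight-sets-do-not-cross {X} {Y} (Shore.tight shore-X) (Shore.tight shore-Y) Xa₀ Ya₀ Xa Ya Yb Xb
                                      (Shore.excludes-v shore-X) (Shore.excludes-v shore-Y))

  record Packing (Xs : List (VertexSet n)) : Set where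
    field
      shores   : All Shore Xs
      disjoint : AllPairs Disjoint Xs

  insert : ∀ {X Xs} → Shore X → Packing Xs → ∃ λ Ys → Packing Ys × ⋃ Ys ≗ X ∪ ⋃ Xs
  insert {X} {Xs} shore packing with any? (X ⊆?_) Xs
  ... | yes covered = Xs , packing , λ a → absorb (⋃-⊇ covered a)
    where
    absorb : ∀ {x y} → (x ≡ true → y ≡ true) → y ≡ x ∨ y
    absorb {true}  x⇒y = x⇒y refl
    absorb {false} x⇒y = refl
  ... | no uncovered = X ∷ filter (disjoint? X) Xs ,
    record { shores   = shore ∷ All.filter⁺ (disjoint? X) (Packing.shores packing)
           ; disjoint = All.all-filter (disjoint? X) Xs ∷ AllPairs.filter⁺ (disjoint? X) (Packing.disjoint packing) } ,
    union
    where
    meets⇒⊆ : All (λ Y → ¬ Disjoint X Y → Y ⊆ X) Xs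
    meets⇒⊆ = All.zipWith (λ (X⊈Y , shore-Y) meets → [ (λ X⊆Y → contradiction X⊆Y X⊈Y) , (λ Y⊆X → Y⊆X) ]′
                                                       (shores-laminar shore shore-Y meets))
                          (All.¬Any⇒All¬ Xs uncovered , Packing.shores packing)
    union : ⋃ (X ∷ filter (disjoint? X) Xs) ≗ X ∪ ⋃ Xs
    union a with X a in Xa
    ... | true  = refl
    ... | false = ⋃-filter-outside Xs meets⇒⊆ Xa

  ⋃-excludes-v : ∀ {Xs} → All Shore Xs → ⋃ Xs v ≡ false
  ⋃-excludes-v []               = refl
  ⋃-excludes-v (shore ∷ shores) = cong₂ _∨_ (Shore.excludes-v shore) (⋃-excludes-v shores)

  shore-cover : ∀ (us : List (Fin n)) → ∃ λ Xs → Packing Xs × (∀ {u} → u ∈ us → u ≢ v → ⋃ Xs u ≡ true)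
  shore-cover []       = [] , record { shores = [] ; disjoint = [] } , λ ()
  shore-cover (u ∷ us) with Xs , packing , covers ← shore-cover us | u ≟ v
  ... | yes refl = Xs , packing , λ { (here refl) u≢u → contradiction refl u≢u ; (there w∈us) → covers w∈us }
  ... | no u≢v
    with X , shore , Xu ← shore-around u≢v
    with Ys , packing′ , ⋃Ys≗ ← insert shore packing =
    Ys , packing′ , λ { (here refl) _ → trans (⋃Ys≗ u) (cong (_∨ ⋃ Xs u) Xu)
                      ; {w} (there w∈us) w≢v →
                          trans (⋃Ys≗ w) (trans (cong (X w ∨_) (covers w∈us w≢v)) (Bool.∨-zeroʳ (X w))) }

  weight : Fin n → ℕ
  weight a = suc (deg (colourClass j) a)

  weighted : VertexSet n → ℕ
  weighted X = ∑[ a < n ] ([ X a ] * weight a)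

  shore-weight-even : ∀ {X} → Shore X → odd (weighted X) ≡ false
  shore-weight-even {X} shore = begin
    odd (weighted X)                              ≡⟨ cong odd split ⟩
    odd (size X + colour-sum)                     ≡⟨ odd-+ (size X) colour-sum ⟩
    odd (size X) xor odd colour-sum               ≡⟨ cong₂ _xor_ (tight⇒odd-size (Shore.tight shore)) colour-parity ⟩
    true xor true                                 ≡⟨⟩
    false                                         ∎
    where
    open ≡-Reasoning
    colour-sum = ∑[ a < n ] ([ X a ] * deg (colourClass j) a)
    split : weighted X ≡ size X + colour-sum
    split = trans (sum-cong-≗ λ a → *-suc [ X a ] (deg (colourClass j) a)) (∑-distrib-+ (λ a → [ X a ]) _)
    colour-parity : odd colour-sum ≡ true
    colour-parity = trans (odd-∑deg≡odd-∂ (colourClass j) (colourClass-sym j) (colourClass-loopless j) X)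
                          (cong odd (Shore.one-j-edge shore))

  weighted-∪ : ∀ {X Y} → Disjoint X Y → weighted (X ∪ Y) ≡ weighted X + weighted Y
  weighted-∪ {X} {Y} X∩Y≡∅ = trans (sum-cong-≗ λ a → trans (cong (_* weight a) (indicator-∨ (X∩Y≡∅ a)))
                                                             (*-distribʳ-+ (weight a) [ X a ] [ Y a ]))
                                   (∑-distrib-+ (λ a → [ X a ] * weight a) _)
    where
    indicator-∨ : ∀ {x y} → (x ≡ true → y ≡ false) → [ x ∨ y ] ≡ [ x ] + [ y ]
    indicator-∨ {true}  x⇒¬y rewrite x⇒¬y refl = refl
    indicator-∨ {false} x⇒¬y = refl

  packing-weight-even : ∀ {Xs} → Packing Xs → odd (weighted (⋃ Xs)) ≡ false
  packing-weight-even {[]}     _       = cong odd (sum-zero {f = λ a → 0 * weight a} λ _ → refl)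
  packing-weight-even {X ∷ Xs} packing with shore ∷ shores ← Packing.shores packing
                                        | X-disjoint ∷ disjoint ← Packing.disjoint packing = begin
    odd (weighted (X ∪ ⋃ Xs))                ≡⟨ cong odd (weighted-∪ (⋃-disjoint X-disjoint)) ⟩
    odd (weighted X + weighted (⋃ Xs))       ≡⟨ odd-+ (weighted X) _ ⟩
    odd (weighted X) xor odd (weighted (⋃ Xs)) ≡⟨ cong₂ _xor_ (shore-weight-even shore)
                                                   (packing-weight-even (record { shores = shores ; disjoint = disjoint })) ⟩
    false                                    ∎
    where open ≡-Reasoning

  colourDeg-odd : odd (deg (colourClass j) v) ≡ true
  colourDeg-odd with Xs , packing , covers ← shore-cover (allFin n) =
    trans (sym (Bool.not-involutive _)) (cong not weight-v-even)
    where
    open ≡-Reasoning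
    partition : ∀ a → [ ⋃ Xs a ] + [ ⌊ v ≟ a ⌋ ] ≡ 1
    partition a with v ≟ a
    ... | yes refl = cong (_+ 1) (cong [_] (⋃-excludes-v (Packing.shores packing)))
    ... | no v≢a   rewrite covers (∈-allFin a) (v≢a ∘ sym) = refl
    total : ∑[ a < n ] weight a ≡ weighted (⋃ Xs) + weight v
    total = begin
      ∑[ a < n ] weight a
        ≡⟨ sum-cong-≗ (λ a → trans (sym (*-identityˡ (weight a))) (cong (_* weight a) (sym (partition a)))) ⟩
      ∑[ a < n ] (([ ⋃ Xs a ] + [ ⌊ v ≟ a ⌋ ]) * weight a)
        ≡⟨ sum-cong-≗ (λ a → *-distribʳ-+ (weight a) [ ⋃ Xs a ] _) ⟩
      ∑[ a < n ] ([ ⋃ Xs a ] * weight a + [ ⌊ v ≟ a ⌋ ] * weight a)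
        ≡⟨ ∑-distrib-+ (λ a → [ ⋃ Xs a ] * weight a) _ ⟩
      weighted (⋃ Xs) + ∑[ a < n ] ([ ⌊ v ≟ a ⌋ ] * weight a)
        ≡⟨ cong (weighted (⋃ Xs) +_) (sum-select v weight) ⟩
      weighted (⋃ Xs) + weight v ∎
    total-even : odd (∑[ a < n ] weight a) ≡ false
    total-even = begin
      odd (∑[ a < n ] weight a)
        ≡⟨ cong odd (∑-distrib-+ (λ _ → 1) (deg (colourClass j))) ⟩
      odd (∑[ a < n ] 1 + ∑[ a < n ] deg (colourClass j) a)
        ≡⟨ odd-+ (∑[ a < n ] 1) _ ⟩
      odd (∑[ a < n ] 1) xor odd (∑[ a < n ] deg (colourClass j) a)
        ≡⟨ cong₂ _xor_ (trans (cong odd (sum-ones n)) order-even)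
                       (degrees-even (colourClass j) (colourClass-sym j) (colourClass-loopless j)) ⟩
      false ∎
    weight-v-even : odd (weight v) ≡ false
    weight-v-even = begin
      odd (weight v)                               ≡⟨ cong (_xor odd (weight v)) (packing-weight-even packing) ⟨
      odd (weighted (⋃ Xs)) xor odd (weight v)     ≡⟨ odd-+ (weighted (⋃ Xs)) (weight v) ⟨
      odd (weighted (⋃ Xs) + weight v)             ≡⟨ cong odd total ⟨
      odd (∑[ a < n ] weight a)                    ≡⟨ total-even ⟩
      false                                        ∎

module _ {n k : ℕ} {G : Graph n} (connected : EdgeConnected k G) where

  no-rainbow-disconnection-below : ∀ m → m < k → ¬ RDColourable G m
  no-rainbow-disconnection-below m m<k (c , rd) with proj₁ connected
  ... | s≤s (s≤s _) with R , _ , rainbow , separated ← rd zero (suc zero) (λ ())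
    = separated (proj₂ connected R (≤-<-trans (Colouring.rainbow⇒length≤ c rainbow) m<k) zero (suc zero))

  module _ (regular : Regular k G) where

    no-proper-colouring-below : ∀ m → m < k → ¬ ProperColourable G m
    no-proper-colouring-below m m<k (c , proper) with proj₁ connected
    ... | s≤s (s≤s _) = <⇒≱ m<k (begin
      k                                       ≡⟨ regular⇒deg≡ G regular zero ⟨
      deg (adj G) zero                        ≡⟨ deg≡∑colourDeg zero ⟩
      ∑[ j < m ] deg (colourClass j) zero     ≤⟨ sum-mono-≤ (λ j → proper⇒colourDeg≤1 proper j zero) ⟩
      ∑[ j < m ] 1                            ≡⟨ sum-ones m ⟩
      m                                       ∎)
      where
      open ≤-Reasoning
      open Colouring c

    rainbowDisconnected⇒proper : odd k ≡ true → (c : EdgeColouring G k) → RainbowDisconnected c → Proper c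
    rainbowDisconnected⇒proper odd-k c rd = colourDeg≤1⇒proper λ j v →
      all≥1∧sum≤n⇒all≤1 (λ i → deg (colourClass i) v) (colourDeg≥1 v) (≤-reflexive (colourDeg-sum v)) j
      where
      open Colouring c
      colourDeg≥1 : ∀ v i → 1 ≤ deg (colourClass i) v
      colourDeg≥1 v i = odd⇒positive (OddColourDegree.colourDeg-odd odd-k connected regular c rd v i)
      colourDeg-sum : ∀ v → ∑[ i < k ] deg (colourClass i) v ≡ k
      colourDeg-sum v = trans (sym (deg≡∑colourDeg v)) (regular⇒deg≡ G regular v)

theorem3p13 : (k n : ℕ) → Odd k → (G : Graph n) → EdgeConnected k G → Regular k G →
    ChromaticIndexIs G k ⇔ RDNumberIs G k
theorem3p13 k n k-odd G connected regular = mk⇔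
  (λ ((c , proper) , _) → (c , Colouring.proper⇒rainbowDisconnected c proper) , no-rainbow-disconnection-below connected)
  (λ ((c , rd) , _) → (c , rainbowDisconnected⇒proper connected regular (Odd⇒odd {k} k-odd) c rd) ,
                      no-proper-colouring-below connected regular)
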